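{- Let $k\ge2$. Define $b(1,k)=1$ and $b(n,k)=nk^{n-1}+b(n-1,k)$ for $n\ge2$. Then for every integer $j\ge1$, \[F\!\left(\frac{k^{j+1}-1}{k-1},\,k\right)=\sum_{n=1}^{j}b(n,k).\]
   Context: Fix an integer $k\ge 2$. Let $T_k$ be the infinite rooted $k$-ary tree (every vertex has exactly $k$ children) with one additional self-loop at the root, so every vertex has degree $k+1$. Chip-firing: a vertex with at least $k+1$ chips may fire, sending one chip along each incident edge (a non-root vertex sends one chip to its parent and one to each of its $k$ children; the root sends one chip to each of its $k$ children and one chip to itself along the self-loop). Starting with $N$ chips at the root and none elsewhere, vertices fire until no vertex can fire; this terminates, and the number of times each vertex fires does not depend on the order of firings. $F(N,k)$ denotes the total number of fires summed over all vertices. -}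

module Defs where

open import Data.Nat using (ℕ; zero; suc; _+_; _*_; _∸_; _^_; _≤_; _<_)
open import Data.Fin using (Fin)
import Data.Fin as Fin
open import Data.List using (List; []; _∷_)
open import Data.List.Properties using (≡-dec)
open import Data.Bool using (if_then_else_)
open import Data.Product using (Σ; _×_)
open import Relation.Nullary.Decidable using (⌊_⌋)
open import Relation.Binary.PropositionalEquality using (_≡_)
open import Relation.Binary using (DecidableEquality)

-- Vertices of the infinite rooted k-ary tree T_k: a vertex is the path from the
-- root, stored in REVERSED order (the head is the last step).
Vertex : ℕ → Set
Vertex k = List (Fin k)

_≟V_ : ∀ {k} → DecidableEquality (Vertex k)
_≟V_ = ≡-dec Fin._≟_

Config : ℕ → Set
Config k = Vertex k → ℕ

-- Number of chips that vertex w receives when vertex v fires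
-- (one per edge between v and w, counting the root self-loop).
childTerm : ∀ {k} → Vertex k → Vertex k → ℕ
childTerm v []      = 0
childTerm v (_ ∷ w) = if ⌊ w ≟V v ⌋ then 1 else 0

parentTerm : ∀ {k} → Vertex k → Vertex k → ℕ
parentTerm []      w = 0
parentTerm (_ ∷ v) w = if ⌊ v ≟V w ⌋ then 1 else 0

loopTerm : ∀ {k} → Vertex k → Vertex k → ℕ
loopTerm []      []      = 1
loopTerm []      (_ ∷ _) = 0
loopTerm (_ ∷ _) _       = 0

received : ∀ {k} → Vertex k → Vertex k → ℕ
received v w = childTerm v w + parentTerm v w + loopTerm v w

-- Chips lost by w when v fires (degree k+1 if w = v).
lost : ∀ k → Vertex k → Vertex k → ℕ
lost k v w = if ⌊ v ≟V w ⌋ then suc k else 0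

fire : ∀ {k} → Config k → Vertex k → Config k
fire {k} c v w = (c w + received v w) ∸ lost k v w

data Steps (k : ℕ) : Config k → ℕ → Config k → Set where
  done : ∀ {c} → Steps k c 0 c
  step : ∀ {c n c'} (v : Vertex k) → suc k ≤ c v →
         Steps k (fire c v) n c' → Steps k c (suc n) c'

Stable : ∀ k → Config k → Set
Stable k c = ∀ v → c v < suc k

initial : ∀ k → ℕ → Config k
initial k N []      = N
initial k N (_ ∷ _) = 0

-- "F(N,k) = m": starting from N chips at the root, some legal firing sequence
-- of total length m reaches a stable configuration. (By the order-independence
-- stated in the context, m is then the total number of fires F(N,k).)
FEquals : ℕ → ℕ → ℕ → Set
FEquals N k m = Σ (Config k) (λ c' → Steps k (initial k N) m c' × Stable k c')

-- b(1,k) = 1, b(n,k) = n k^(n-1) + b(n-1,k) for n ≥ 2 (b(0,k) unused, set 0).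
b : ℕ → ℕ → ℕ
b zero k = 0
b (suc zero) k = 1
b (suc (suc n)) k = suc (suc n) * k ^ suc n + b (suc n) k

sumB : ℕ → ℕ → ℕ
sumB zero k = 0
sumB (suc j) k = b (suc j) k + sumB j k

{-# OPTIONS --safe #-}
-- All configurations met are level-symmetric (every vertex of depth d holds
-- the same number p d of chips), so they are described by profiles p : ℕ → ℕ.
-- Firing every vertex of depth t, then every vertex of depth t − 1, ..., then
-- the root, i.e. 1 + k + ⋯ + k^t = ballSize t fires, moves k chips from each
-- vertex of depth t to its children, one each, provided every shallower vertex
-- holds a chip: each level returns k chips per vertex to the level above, which
-- then fires in turn. With one chip on every shallower vertex, a depth holding
-- 1 + k B chips per vertex is thus brought down to one chip by B such rounds,
-- leaving B chips per vertex one level deeper. Starting from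
-- N = (k^(j+1) − 1)/(k − 1) = ballSize j chips at the root, this ends with
-- exactly one chip on every vertex of depth ≤ j, which is stable, after
-- Σ_{t<j} ballSize (j − 1 − t) · ballSize t fires; that sum obeys the same
-- recursion X (j + 1) = Σ_{t≤j} ballSize t + k X j as Σ_{n≤j} b(n,k).
module Submission where

open import Defs
open import Data.Nat using (ℕ; _≤_; _+_; _*_; _∸_; _^_)
open import Relation.Binary.PropositionalEquality using (_≡_)

open import Algebra.Bundles using (CommutativeMonoid)
import Algebra.Construct.Pointwise as Pointwise
open import Data.Bool using (true; false; if_then_else_; _∧_)
open import Data.Bool.Properties using (if-∧)
open import Data.Fin using (Fin)
import Data.Fin as Fin
open import Data.List using (List; []; _∷_; [_]; _++_; map; concatMap; length; tabulate)
open import Data.List.Properties using (length-++; length-tabulate; map-++; map-tabulate; map-cong; tabulate-cong)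
open import Data.Nat using (zero; suc; z≤n; s≤s)
open import Data.Nat.ListAction using (sum)
open import Data.Nat.ListAction.Properties using (sum-++)
open import Data.Nat.Properties
open import Data.Nat.Tactic.RingSolver using (solve-∀)
open import Data.Product using (∃-syntax; _×_; _,_)
open import Relation.Binary.PropositionalEquality
  using (refl; sym; trans; cong; cong₂; subst; _≗_; module ≡-Reasoning)
open import Relation.Nullary.Decidable using (⌊_⌋; does; map′; isYes≗does; dec-true; does-≡)

open import Algebra.Properties.CommutativeSemigroup +-commutativeSemigroup
  using (interchange; x∙yz≈xz∙y; xy∙z≈xz∙y)

sum-map-+ : ∀ {A : Set} (f g : A → ℕ) xs →
            sum (map (λ x → f x + g x) xs) ≡ sum (map f xs) + sum (map g xs)
sum-map-+ f g [] = refl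
sum-map-+ f g (x ∷ xs) =
  trans (cong (f x + g x +_) (sum-map-+ f g xs)) (interchange (f x) (g x) (sum (map f xs)) _)

sum-map-zero : ∀ {A : Set} (xs : List A) → sum (map (λ _ → 0) xs) ≡ 0
sum-map-zero [] = refl
sum-map-zero (_ ∷ xs) = sum-map-zero xs

sum-map-concatMap : ∀ {A B : Set} (f : B → ℕ) (g : A → List B) xs →
                    sum (map f (concatMap g xs)) ≡ sum (map (λ x → sum (map f (g x))) xs)
sum-map-concatMap f g [] = refl
sum-map-concatMap f g (x ∷ xs) = begin
  sum (map f (g x ++ concatMap g xs))               ≡⟨ cong sum (map-++ f (g x) _) ⟩
  sum (map f (g x) ++ map f (concatMap g xs))       ≡⟨ sum-++ (map f (g x)) _ ⟩
  sum (map f (g x)) + sum (map f (concatMap g xs))  ≡⟨ cong (_ +_) (sum-map-concatMap f g xs) ⟩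
  sum (map f (g x)) + sum (map (λ x → sum (map f (g x))) xs) ∎
  where open ≡-Reasoning

length-concatMap-const : ∀ {A B : Set} {n} (g : A → List B) → (∀ x → length (g x) ≡ n) →
                         ∀ xs → length (concatMap g xs) ≡ length xs * n
length-concatMap-const g length-g [] = refl
length-concatMap-const g length-g (x ∷ xs) =
  trans (length-++ (g x)) (cong₂ _+_ (length-g x) (length-concatMap-const g length-g xs))

sum-tabulate-const : ∀ n a → sum (tabulate {n = n} (λ _ → a)) ≡ n * a
sum-tabulate-const zero a = refl
sum-tabulate-const (suc n) a = cong (a +_) (sum-tabulate-const n a)

sum-tabulate-if-≟ : ∀ {n} (j : Fin n) a → sum (tabulate (λ i → if does (i Fin.≟ j) then a else 0)) ≡ a
sum-tabulate-if-≟ {suc n} Fin.zero a =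
  trans (cong (a +_) (trans (sum-tabulate-const n 0) (*-zeroʳ n))) (+-identityʳ a)
sum-tabulate-if-≟ {suc n} (Fin.suc j) a = sum-tabulate-if-≟ {n} j a

steps-++ : ∀ {k c m c′ n c″} → Steps k c m c′ → Steps k c′ n c″ → Steps k c (m + n) c″
steps-++ done        s′ = s′
steps-++ (step v l s) s′ = step v l (steps-++ s s′)

Profile : Set
Profile = ℕ → ℕ

profile-commutativeMonoid : CommutativeMonoid _ _
profile-commutativeMonoid = Pointwise.commutativeMonoid ℕ +-0-commutativeMonoid

open CommutativeMonoid profile-commutativeMonoid
  using (ε; assoc; ∙-congˡ) renaming (_∙_ to _⊕_; sym to ≗-sym)
open import Algebra.Properties.Monoid.Mult (CommutativeMonoid.monoid profile-commutativeMonoid)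
  using (×-homo-1; ×-assocˡ) renaming (_×_ to _·_)
open import Algebra.Solver.CommutativeMonoid profile-commutativeMonoid
  using (solve; _⊜_) renaming (_⊕_ to _⊞_)

·-apply : ∀ n (p : Profile) e → (n · p) e ≡ n * p e
·-apply zero p e = refl
·-apply (suc n) p e = cong (p e +_) (·-apply n p e)

δ : ℕ → Profile
δ zero    zero    = 1
δ zero    (suc _) = 0
δ (suc t) zero    = 0
δ (suc t) (suc e) = δ t e

ones : ℕ → Profile
ones zero    = ε
ones (suc t) = ones t ⊕ δ t

ones-≤1 : ∀ t e → ones t e ≤ 1
ones-≤1 zero e = z≤n
ones-≤1 (suc t) zero = ≤-reflexive (top t)
  where
  top : ∀ t → ones (suc t) 0 ≡ 1
  top zero = refl
  top (suc t) = trans (+-identityʳ _) (top t)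
ones-≤1 (suc t) (suc e) = ≤-trans (≤-reflexive (shift t e)) (ones-≤1 t e)
  where
  shift : ∀ t e → ones (suc t) (suc e) ≡ ones t e
  shift zero e = refl
  shift (suc t) e = cong (_+ δ t e) (shift t e)

module _ (k : ℕ) where

  children : Vertex k → List (Vertex k)
  children v = tabulate (_∷ v)

  level : ℕ → List (Vertex k)
  level zero    = [ [] ]
  level (suc d) = concatMap children (level d)

  length-level : ∀ d → length (level d) ≡ k ^ d
  length-level zero    = refl
  length-level (suc d) = begin
    length (concatMap children (level d))
      ≡⟨ length-concatMap-const children (λ v → length-tabulate (_∷ v)) (level d) ⟩
    length (level d) * k  ≡⟨ cong (_* k) (length-level d) ⟩
    k ^ d * k             ≡⟨ *-comm (k ^ d) k ⟩
    k ^ suc d             ∎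
    where open ≡-Reasoning

  sum-level-suc : ∀ d (f : Vertex k → ℕ) →
    sum (map f (level (suc d))) ≡ sum (map (λ v → sum (tabulate (λ i → f (i ∷ v)))) (level d))
  sum-level-suc d f = trans (sum-map-concatMap f children (level d))
    (cong sum (map-cong (λ v → cong sum (map-tabulate (_∷ v) f)) (level d)))

  sum-level-suc-nonroot : ∀ d (f : Vertex k → ℕ) → (∀ i v → f (i ∷ v) ≡ 0) →
                          sum (map f (level (suc d))) ≡ 0
  sum-level-suc-nonroot d f f≡0 = begin
    sum (map f (level (suc d)))                                   ≡⟨ sum-level-suc d f ⟩
    sum (map (λ v → sum (tabulate (λ i → f (i ∷ v)))) (level d))
      ≡⟨ cong sum (map-cong (λ v → trans (cong sum (tabulate-cong (λ i → f≡0 i v)))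
                                         (trans (sum-tabulate-const k 0) (*-zeroʳ k))) (level d)) ⟩
    sum (map (λ _ → 0) (level d))                                 ≡⟨ sum-map-zero (level d) ⟩
    0                                                             ∎
    where open ≡-Reasoning

  -- Stated with does rather than ⌊_⌋ as in Defs: does ((i ∷ v) ≟V (j ∷ w)) computes to
  -- does (i Fin.≟ j) ∧ does (v ≟V w), whereas ⌊_⌋ is stuck on the decision for cons lists.
  sum-level-if-≟ : ∀ d a w →
    sum (map (λ v → if does (v ≟V w) then a else 0) (level d)) ≡ a * δ d (length w)
  sum-level-if-≟ zero    a []      = trans (+-identityʳ a) (sym (*-identityʳ a))
  sum-level-if-≟ zero    a (_ ∷ _) = sym (*-zeroʳ a)
  sum-level-if-≟ (suc d) a []      = trans (sum-level-suc-nonroot d _ (λ _ _ → refl)) (sym (*-zeroʳ a))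
  sum-level-if-≟ (suc d) a (j ∷ w) = begin
    sum (map (λ v → if does (v ≟V (j ∷ w)) then a else 0) (level (suc d)))
      ≡⟨ sum-level-suc d _ ⟩
    sum (map (λ v → sum (tabulate (λ i → if does (i Fin.≟ j) ∧ does (v ≟V w) then a else 0))) (level d))
      ≡⟨ cong sum (map-cong (λ v → trans (cong sum (tabulate-cong (λ i → if-∧ (does (i Fin.≟ j)))))
                                         (sum-tabulate-if-≟ j _)) (level d)) ⟩
    sum (map (λ v → if does (v ≟V w) then a else 0) (level d))
      ≡⟨ sum-level-if-≟ d a w ⟩
    a * δ d (length w) ∎
    where open ≡-Reasoning

  if-⌊⌋≡if-does : ∀ a (v w : Vertex k) →
                  (if ⌊ v ≟V w ⌋ then a else 0) ≡ (if does (v ≟V w) then a else 0)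
  if-⌊⌋≡if-does a v w = cong (λ b → if b then a else 0) (isYes≗does (v ≟V w))

  sum-lost-level : ∀ d w → sum (map (λ v → lost k v w) (level d)) ≡ (suc k · δ d) (length w)
  sum-lost-level d w = begin
    sum (map (λ v → lost k v w) (level d))
      ≡⟨ cong sum (map-cong (λ v → if-⌊⌋≡if-does (suc k) v w) (level d)) ⟩
    sum (map (λ v → if does (v ≟V w) then suc k else 0) (level d))  ≡⟨ sum-level-if-≟ d (suc k) w ⟩
    suc k * δ d (length w)                                           ≡⟨ ·-apply (suc k) (δ d) _ ⟨
    (suc k · δ d) (length w)                                         ∎
    where open ≡-Reasoning

  sum-child-level : ∀ d w → sum (map (λ v → childTerm v w) (level d)) ≡ δ (suc d) (length w)
  sum-child-level d []      = sum-map-zero (level d)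
  sum-child-level d (j ∷ w) = begin
    sum (map (λ v → childTerm v (j ∷ w)) (level d))
      ≡⟨ cong sum (map-cong (λ v → trans (if-⌊⌋≡if-does 1 w v) (cong (λ b → if b then 1 else 0) (flip v)))
                            (level d)) ⟩
    sum (map (λ v → if does (v ≟V w) then 1 else 0) (level d))  ≡⟨ sum-level-if-≟ d 1 w ⟩
    1 * δ d (length w)                                            ≡⟨ *-identityˡ _ ⟩
    δ d (length w)                                                ∎
    where
    open ≡-Reasoning
    flip : ∀ (v : Vertex k) → does (w ≟V v) ≡ does (v ≟V w)
    flip v = does-≡ (w ≟V v) (map′ sym sym (v ≟V w))

  sum-parent-level : ∀ d w → sum (map (λ v → parentTerm v w) (level (suc d))) ≡ (k · δ d) (length w)
  sum-parent-level d w = begin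
    sum (map (λ v → parentTerm v w) (level (suc d)))  ≡⟨ sum-level-suc d _ ⟩
    sum (map (λ v → sum (tabulate {n = k} (λ _ → if ⌊ v ≟V w ⌋ then 1 else 0))) (level d))
      ≡⟨ cong sum (map-cong (λ v → trans (cong (λ x → sum (tabulate {n = k} (λ _ → x)))
                                                (if-⌊⌋≡if-does 1 v w))
                                         (copies (does (v ≟V w))))
                            (level d)) ⟩
    sum (map (λ v → if does (v ≟V w) then k else 0) (level d))  ≡⟨ sum-level-if-≟ d k w ⟩
    k * δ d (length w)                                            ≡⟨ ·-apply k (δ d) (length w) ⟨
    (k · δ d) (length w)                                          ∎
    where
    open ≡-Reasoning
    copies : ∀ b → sum (tabulate {n = k} (λ _ → if b then 1 else 0)) ≡ (if b then k else 0)
    copies true  = trans (sum-tabulate-const k 1) (*-identityʳ k)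
    copies false = trans (sum-tabulate-const k 0) (*-zeroʳ k)

  -- When all of level d fires, each vertex of depth d + 1 gains a chip from its parent, and the
  -- chips sent back up give k to each vertex of depth d − 1, or one to the root through its loop.
  backflow : ℕ → Profile
  backflow zero    = δ 0
  backflow (suc d) = k · δ d

  inflow : ℕ → Profile
  inflow d = δ (suc d) ⊕ backflow d

  sum-backflow-level : ∀ d w →
    sum (map (λ v → parentTerm v w) (level d)) + sum (map (λ v → loopTerm v w) (level d))
      ≡ backflow d (length w)
  sum-backflow-level zero    []      = refl
  sum-backflow-level zero    (_ ∷ _) = refl
  sum-backflow-level (suc d) w       =
    trans (cong₂ _+_ (sum-parent-level d w) (sum-level-suc-nonroot d _ (λ _ _ → refl))) (+-identityʳ _)

  sum-received-level : ∀ d w → sum (map (λ v → received v w) (level d)) ≡ inflow d (length w)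
  sum-received-level d w = begin
    sum (map (λ v → received v w) (level d))
      ≡⟨ sum-map-+ (λ v → childTerm v w + parentTerm v w) (λ v → loopTerm v w) (level d) ⟩
    sum (map (λ v → childTerm v w + parentTerm v w) (level d)) + Σloop
      ≡⟨ cong (_+ Σloop) (sum-map-+ (λ v → childTerm v w) (λ v → parentTerm v w) (level d)) ⟩
    Σchild + Σparent + Σloop    ≡⟨ +-assoc Σchild Σparent Σloop ⟩
    Σchild + (Σparent + Σloop)  ≡⟨ cong₂ _+_ (sum-child-level d w) (sum-backflow-level d w) ⟩
    inflow d (length w)         ∎
    where
    open ≡-Reasoning
    Σchild Σparent Σloop : ℕ
    Σchild = sum (map (λ v → childTerm v w) (level d))
    Σparent = sum (map (λ v → parentTerm v w) (level d))
    Σloop = sum (map (λ v → loopTerm v w) (level d))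

  lost-self : ∀ v → lost k v v ≡ suc k
  lost-self v =
    trans (if-⌊⌋≡if-does (suc k) v v) (cong (λ b → if b then suc k else 0) (dec-true (v ≟V v) refl))

  fire-all : ∀ (vs : List (Vertex k)) c →
    (∀ w → sum (map (λ v → lost k v w) vs) ≤ c w) →
    ∃[ c′ ] Steps k c (length vs) c′ ×
      (∀ w → c′ w + sum (map (λ v → lost k v w) vs) ≡ c w + sum (map (λ v → received v w) vs))
  fire-all []       c _      = c , done , λ _ → refl
  fire-all (v ∷ vs) c enough =
    let c′ , steps , balance = fire-all vs (fire c v) enough′
    in  c′ , step v legal steps , λ w → balance′ w (balance w)
    where
    Σlost Σreceived : Vertex k → ℕ
    Σlost w = sum (map (λ u → lost k u w) vs)
    Σreceived w = sum (map (λ u → received u w) vs)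

    fire-balance : ∀ w → fire c v w + lost k v w ≡ c w + received v w
    fire-balance w = m∸n+n≡m (≤-trans (m≤m+n (lost k v w) _) (≤-trans (enough w) (m≤m+n (c w) _)))

    legal : suc k ≤ c v
    legal = subst (_≤ c v) (lost-self v) (≤-trans (m≤m+n _ _) (enough v))

    enough′ : ∀ w → Σlost w ≤ fire c v w
    enough′ w = +-cancelʳ-≤ (lost k v w) _ _ (begin
      Σlost w + lost k v w        ≡⟨ +-comm (Σlost w) _ ⟩
      lost k v w + Σlost w        ≤⟨ enough w ⟩
      c w                         ≤⟨ m≤m+n (c w) _ ⟩
      c w + received v w          ≡⟨ fire-balance w ⟨
      fire c v w + lost k v w     ∎)
      where open ≤-Reasoning

    balance′ : ∀ w {x} → x + Σlost w ≡ fire c v w + Σreceived w →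
               x + (lost k v w + Σlost w) ≡ c w + (received v w + Σreceived w)
    balance′ w {x} eq = begin
      x + (lost k v w + Σlost w)                ≡⟨ x∙yz≈xz∙y x _ _ ⟩
      x + Σlost w + lost k v w                  ≡⟨ cong (_+ lost k v w) eq ⟩
      fire c v w + Σreceived w + lost k v w     ≡⟨ xy∙z≈xz∙y (fire c v w) _ _ ⟩
      fire c v w + lost k v w + Σreceived w     ≡⟨ cong (_+ Σreceived w) (fire-balance w) ⟩
      c w + received v w + Σreceived w          ≡⟨ +-assoc (c w) _ _ ⟩
      c w + (received v w + Σreceived w)        ∎
      where open ≡-Reasoning

  HasProfile : Config k → Profile → Set
  HasProfile c p = ∀ w → c w ≡ p (length w)

  infix 4 _↝[_]_
  record _↝[_]_ (p : Profile) (m : ℕ) (q : Profile) : Set where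
    field reach : ∀ c → HasProfile c p → ∃[ c′ ] Steps k c m c′ × HasProfile c′ q
  open _↝[_]_

  ↝-refl : ∀ {p} → p ↝[ 0 ] p
  ↝-refl .reach c c∼p = c , done , c∼p

  ↝-resp : ∀ {p p′ q q′ m} → p′ ≗ p → q ≗ q′ → p ↝[ m ] q → p′ ↝[ m ] q′
  ↝-resp p′≗p q≗q′ p↝q .reach c c∼p′ =
    let c′ , steps , c′∼q = p↝q .reach c (λ w → trans (c∼p′ w) (p′≗p (length w)))
    in  c′ , steps , λ w → trans (c′∼q w) (q≗q′ (length w))

  ↝-cast : ∀ {p q m n} → m ≡ n → p ↝[ m ] q → p ↝[ n ] q
  ↝-cast refl p↝q = p↝q

  ↝-trans : ∀ {p q r m n} → p ↝[ m ] q → q ↝[ n ] r → p ↝[ m + n ] r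
  ↝-trans p↝q q↝r .reach c c∼p =
    let c₁ , steps₁ , c₁∼q = p↝q .reach c c∼p
        c₂ , steps₂ , c₂∼r = q↝r .reach c₁ c₁∼q
    in  c₂ , steps-++ steps₁ steps₂ , c₂∼r

  fire-level : ∀ d p → p ⊕ suc k · δ d ↝[ k ^ d ] p ⊕ inflow d
  fire-level d p .reach c c∼ =
    let c′ , steps , balance = fire-all (level d) c enough
    in  c′ , subst (λ n → Steps k c n c′) (length-level d) steps , λ w → profile′ w (balance w)
    where
    Σlost Σreceived : Vertex k → ℕ
    Σlost w = sum (map (λ v → lost k v w) (level d))
    Σreceived w = sum (map (λ v → received v w) (level d))

    enough : ∀ w → Σlost w ≤ c w
    enough w = begin
      Σlost w                                    ≡⟨ sum-lost-level d w ⟩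
      (suc k · δ d) (length w)                   ≤⟨ m≤n+m _ (p (length w)) ⟩
      p (length w) + (suc k · δ d) (length w)    ≡⟨ c∼ w ⟨
      c w                                        ∎
      where open ≤-Reasoning

    profile′ : ∀ w {x} → x + Σlost w ≡ c w + Σreceived w → x ≡ p (length w) + inflow d (length w)
    profile′ w {x} eq = +-cancelʳ-≡ ((suc k · δ d) (length w)) x _ (begin
      x + (suc k · δ d) (length w)                                   ≡⟨ cong (x +_) (sum-lost-level d w) ⟨
      x + Σlost w                                                    ≡⟨ eq ⟩
      c w + Σreceived w                                              ≡⟨ cong₂ _+_ (c∼ w) (sum-received-level d w) ⟩
      p (length w) + (suc k · δ d) (length w) + inflow d (length w)  ≡⟨ xy∙z≈xz∙y (p (length w)) _ _ ⟩
      p (length w) + inflow d (length w) + (suc k · δ d) (length w)  ∎)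
      where open ≡-Reasoning

  ballSize : ℕ → ℕ
  ballSize zero    = 1
  ballSize (suc n) = suc (ballSize n * k)

  ballSize-suc : ∀ n → ballSize (suc n) ≡ k ^ suc n + ballSize n
  ballSize-suc zero    =
    trans (+-comm 1 (1 * k)) (cong (_+ 1) (trans (*-identityˡ k) (sym (*-identityʳ k))))
  ballSize-suc (suc n) = begin
    suc (ballSize (suc n) * k)             ≡⟨ cong (λ x → suc (x * k)) (ballSize-suc n) ⟩
    suc ((k ^ suc n + ballSize n) * k)     ≡⟨ cong suc (*-distribʳ-+ k (k ^ suc n) _) ⟩
    suc (k ^ suc n * k + ballSize n * k)   ≡⟨ +-suc (k ^ suc n * k) _ ⟨
    k ^ suc n * k + ballSize (suc n)       ≡⟨ cong (_+ ballSize (suc n)) (*-comm (k ^ suc n) k) ⟩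
    k ^ suc (suc n) + ballSize (suc n)     ∎
    where open ≡-Reasoning

  pass-down : ∀ t P →
    (P ⊕ ones t) ⊕ suc k · δ t ↝[ ballSize t ] (P ⊕ ones t) ⊕ (δ (suc t) ⊕ δ t)
  pass-down zero    P = fire-level 0 (P ⊕ ones 0)
  pass-down (suc s) P = ↝-cast (sym (ballSize-suc s))
    (↝-trans (fire-level (suc s) (P ⊕ ones (suc s)))
             (↝-resp (solve 5 (λ P O a b c → (P ⊞ (O ⊞ a)) ⊞ (c ⊞ b) ⊜ ((P ⊞ c) ⊞ O) ⊞ (a ⊞ b)) (λ _ → refl)
                              P (ones s) (δ s) (k · δ s) (δ (suc (suc s))))
                     (solve 5 (λ P O a b c → ((P ⊞ c) ⊞ O) ⊞ (b ⊞ a) ⊜ (P ⊞ (O ⊞ a)) ⊞ (c ⊞ b)) (λ _ → refl)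
                              P (ones s) (δ s) (δ (suc s)) (δ (suc (suc s))))
                     (pass-down s (P ⊕ δ (suc (suc s))))))

  pass-down-times : ∀ t r Q →
    (Q ⊕ ones t) ⊕ (δ t ⊕ r · (k · δ t)) ↝[ r * ballSize t ] (Q ⊕ ones t) ⊕ (δ t ⊕ r · δ (suc t))
  pass-down-times t zero    Q = ↝-refl
  pass-down-times t (suc r) Q = ↝-trans
    (↝-resp (solve 5 (λ Q O a K R → (Q ⊞ O) ⊞ (a ⊞ (K ⊞ R)) ⊜ ((Q ⊞ R) ⊞ O) ⊞ (a ⊞ K)) (λ _ → refl)
                     Q (ones t) (δ t) (k · δ t) (r · (k · δ t)))
            (solve 5 (λ Q O a c R → ((Q ⊞ R) ⊞ O) ⊞ (c ⊞ a) ⊜ ((Q ⊞ c) ⊞ O) ⊞ (a ⊞ R)) (λ _ → refl)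
                     Q (ones t) (δ t) (δ (suc t)) (r · (k · δ t)))
            (pass-down t (Q ⊕ r · (k · δ t))))
    (↝-resp (λ _ → refl)
            (solve 5 (λ Q O a c S → ((Q ⊞ c) ⊞ O) ⊞ (a ⊞ S) ⊜ (Q ⊞ O) ⊞ (a ⊞ (c ⊞ S))) (λ _ → refl)
                     Q (ones t) (δ t) (δ (suc t)) (r · δ (suc t)))
            (pass-down-times t r (Q ⊕ δ (suc t))))

  settle-depth : ∀ t m →
    ones t ⊕ ballSize (suc m) · δ t ↝[ ballSize m * ballSize t ] ones (suc t) ⊕ ballSize m · δ (suc t)
  settle-depth t m = ↝-resp (∙-congˡ {ones t} (∙-congˡ {δ t} (≗-sym (×-assocˡ (δ t) (ballSize m) k))))
                            (≗-sym (assoc (ones t) (δ t) (ballSize m · δ (suc t))))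
                            (pass-down-times t (ballSize m) ε)

  settleCost : ℕ → ℕ → ℕ
  settleCost zero    t = 0
  settleCost (suc m) t = ballSize m * ballSize t + settleCost m (suc t)

  settle : ∀ m t → ones t ⊕ ballSize m · δ t ↝[ settleCost m t ] ones (suc (m + t))
  settle zero    t = ↝-resp (∙-congˡ {ones t} (×-homo-1 (δ t))) (λ _ → refl) ↝-refl
  settle (suc m) t = ↝-trans (settle-depth t m)
    (↝-resp (λ _ → refl) (λ e → cong (λ n → ones (suc n) e) (+-suc m t)) (settle m (suc t)))

  ballSizeSum : ℕ → ℕ
  ballSizeSum zero    = 0
  ballSizeSum (suc m) = ballSize m + ballSizeSum m

  settleCost-suc : ∀ m t → settleCost m (suc t) ≡ ballSizeSum m + k * settleCost m t
  settleCost-suc zero    t = sym (*-zeroʳ k)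
  settleCost-suc (suc m) t = begin
    ballSize m * suc (ballSize t * k) + settleCost m (suc (suc t))
      ≡⟨ cong (ballSize m * suc (ballSize t * k) +_) (settleCost-suc m (suc t)) ⟩
    ballSize m * suc (ballSize t * k) + (ballSizeSum m + k * settleCost m (suc t))
      ≡⟨ rearrange k (ballSize m) (ballSize t) (ballSizeSum m) (settleCost m (suc t)) ⟩
    ballSize m + ballSizeSum m + k * (ballSize m * ballSize t + settleCost m (suc t)) ∎
    where
    open ≡-Reasoning
    rearrange : ∀ k a b S R → a * suc (b * k) + (S + k * R) ≡ a + S + k * (a * b + R)
    rearrange = solve-∀

  settleCost-zero-suc : ∀ j → settleCost (suc j) 0 ≡ ballSizeSum (suc j) + k * settleCost j 0
  settleCost-zero-suc j =
    trans (cong₂ _+_ (*-identityʳ (ballSize j)) (settleCost-suc j 0)) (sym (+-assoc (ballSize j) _ _))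

  b-unfold : ∀ n → b (suc n) k ≡ suc n * k ^ n + b n k
  b-unfold zero    = refl
  b-unfold (suc n) = refl

  b-suc : ∀ n → b (suc n) k ≡ k * b n k + ballSize n
  b-suc zero    = cong (_+ 1) (sym (*-zeroʳ k))
  b-suc (suc n) = begin
    suc (suc n) * k ^ suc n + b (suc n) k                 ≡⟨ cong (suc (suc n) * k ^ suc n +_) (b-suc n) ⟩
    suc (suc n) * k ^ suc n + (k * b n k + ballSize n)    ≡⟨ rearrange k n (k ^ n) (b n k) (ballSize n) ⟩
    k * (suc n * k ^ n + b n k) + (k ^ suc n + ballSize n)
      ≡⟨ cong₂ (λ x y → k * x + y) (b-unfold n) (ballSize-suc n) ⟨
    k * b (suc n) k + ballSize (suc n)                    ∎
    where
    open ≡-Reasoning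
    rearrange : ∀ k n P B S → suc (suc n) * (k * P) + (k * B + S) ≡ k * (suc n * P + B) + (k * P + S)
    rearrange = solve-∀

  sumB-suc : ∀ j → sumB (suc j) k ≡ ballSizeSum (suc j) + k * sumB j k
  sumB-suc zero    = cong suc (sym (*-zeroʳ k))
  sumB-suc (suc j) = trans (cong₂ _+_ (b-suc (suc j)) (sumB-suc j))
                           (rearrange k (b (suc j) k) (ballSize (suc j)) (ballSizeSum (suc j)) (sumB j k))
    where
    rearrange : ∀ k B N S T → k * B + N + (S + k * T) ≡ N + S + k * (B + T)
    rearrange = solve-∀

  settleCost-sumB : ∀ j → settleCost j 0 ≡ sumB j k
  settleCost-sumB zero    = refl
  settleCost-sumB (suc j) = begin
    settleCost (suc j) 0                      ≡⟨ settleCost-zero-suc j ⟩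
    ballSizeSum (suc j) + k * settleCost j 0  ≡⟨ cong (λ x → ballSizeSum (suc j) + k * x) (settleCost-sumB j) ⟩
    ballSizeSum (suc j) + k * sumB j k        ≡⟨ sumB-suc j ⟨
    sumB (suc j) k                            ∎
    where open ≡-Reasoning

  initial-profile : ∀ N → HasProfile (initial k N) (ones 0 ⊕ N · δ 0)
  initial-profile N []      = sym (trans (·-apply N (δ 0) 0) (*-identityʳ N))
  initial-profile N (_ ∷ w) = sym (trans (·-apply N (δ 0) (suc (length w))) (*-zeroʳ N))

  F-ballSize : 1 ≤ k → ∀ j → FEquals (ballSize j) k (sumB j k)
  F-ballSize 1≤k j =
    let c′ , steps , c′∼ones = settle j 0 .reach (initial k (ballSize j)) (initial-profile (ballSize j))
    in  c′ , subst (λ m → Steps k (initial k (ballSize j)) m c′) (settleCost-sumB j) steps ,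
        λ w → s≤s (≤-trans (≤-reflexive (c′∼ones w)) (≤-trans (ones-≤1 (suc (j + 0)) _) 1≤k))

ballSize-geometric : ∀ q n → ballSize (suc q) n * q + 1 ≡ suc q ^ suc n
ballSize-geometric q zero    = trans (+-comm (1 * q) 1) (cong suc (*-comm 1 q))
ballSize-geometric q (suc n) = begin
  ballSize (suc q) (suc n) * q + 1         ≡⟨ rearrange q (ballSize (suc q) n) ⟩
  suc q * (ballSize (suc q) n * q + 1)     ≡⟨ cong (suc q *_) (ballSize-geometric q n) ⟩
  suc q ^ suc (suc n)                      ∎
  where
  open ≡-Reasoning
  rearrange : ∀ q B → suc (B * suc q) * q + 1 ≡ suc q * (B * q + 1)
  rearrange = solve-∀

mainTheorem13 : (k : ℕ) → 2 ≤ k → (j : ℕ) → 1 ≤ j →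
    (N : ℕ) → N * (k ∸ 1) ≡ k ^ (1 + j) ∸ 1 →
    FEquals N k (sumB j k)
mainTheorem13 k@(suc (suc q)) (s≤s (s≤s _)) j _ N N[k-1]≡k^[1+j]-1 =
  subst (λ n → FEquals n k (sumB j k)) (sym N≡ballSize) (F-ballSize k (s≤s z≤n) j)
  where
  open ≡-Reasoning
  N≡ballSize : N ≡ ballSize k j
  N≡ballSize = *-cancelʳ-≡ N (ballSize k j) (suc q) (begin
    N * suc q                      ≡⟨ N[k-1]≡k^[1+j]-1 ⟩
    k ^ suc j ∸ 1                  ≡⟨ cong (_∸ 1) (ballSize-geometric (suc q) j) ⟨
    ballSize k j * suc q + 1 ∸ 1   ≡⟨ m+n∸n≡m (ballSize k j * suc q) 1 ⟩
    ballSize k j * suc q           ∎)
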